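{- Consider the following algorithm for the Domain Monitoring Problem over $T$ time steps: in every time step $t$, the server invokes the protocol $\textsc{Protocol}(nil,1)$ described in the context (with $status_i=1$ for all nodes $i$). It sets $D_t$ to the set of values received in that invocation and, for each received value $v$, takes a node that broadcast $v$ as its representative $j_v$; every other value gets $j_v=\mathrm{nil}$. This algorithm solves the Domain Monitoring Problem for $T$ time steps using $\Theta\left(\sum_{t\in T}|D_t|\right)$ messages on expectation.
   Context: Model (continuous distributed monitoring). There are $n$ nodes with IDs $1,\dots,n$ and one server. At every discrete time step $t$, node $i$ observes a value $v_i^t\in\{1,\dots,\Delta\}$. Nodes can send single-cast messages to the server, and the server can broadcast to all nodes. A broadcast by a node is also allowed; it is implemented as a single-cast message followed by a server broadcast. Every message, single-cast or broadcast, costs one unit. Between two consecutive time steps a communication protocol with polylogarithmically many rounds may be run. The cost of an algorithm is the number of messages it exchanges. The domain at time $t$ is $D_t=\{v\in\{1,\dots,\Delta\}:\exists i,\ v_i^t=v\}$. The Domain Monitoring Problem asks the server, at every time $t$, to know $D_t$ and a sequence $R_t=(j_1,\dots,j_\Delta)$ with $v_{j_v}^t=v$ for every $v\in D_t$ and $j_v=\mathrm{nil}$ for every $v\notin D_t$. Protocol $\textsc{Protocol}(v,status)$, run at a fixed time $t$, where $v\in\{1,\dots,\Delta\}\cup\{nil\}$ and each node keeps a bit $status_i\in\{0,1\}$. The participating nodes are those $i$ with $status_i=status$ and, if $v\neq nil$, also $v_i^t=v$. Each participating node $i$ draws $\hat h_i$ from a geometric distribution with success probability $1/2$ on $\{1,2,\dots\}$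 and sets $h_i=\min\{\log n,\hat h_i\}$; here $\log$ is base 2 and $\log n$ is treated as an integer. In communication round $\log n-h_i$, node $i$ broadcasts its value $v_i^t$, unless some participating node $i'$ with $v_{i'}^t=v_i^t$ has already broadcast in an earlier round. -}

module Defs where

open import Data.Nat using (ℕ; zero; suc; _∸_; _<ᵇ_; _≡ᵇ_)
open import Data.Nat.Logarithm using (⌈log₂_⌉)
open import Data.Fin using (Fin; toℕ; zero; suc)
open import Data.Bool using (Bool; true; false; _∧_; _∨_; not; if_then_else_)
open import Data.Maybe using (Maybe; just; nothing; is-just)
open import Data.Product using (_×_; _,_)
open import Data.List using (List; []; _∷_)
open import Data.Rational using (ℚ; 0ℚ; 1ℚ; ½; _+_; _*_)
import Data.Vec.Functional as VF
import Data.Rational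
import Data.Integer
import Data.List.Membership.Propositional

-- L = "log n treated as an integer" : we take ⌈log₂ n⌉
logN : ℕ → ℕ
logN n = ⌈log₂ n ⌉

halfPow : ℕ → ℚ
halfPow zero = 1ℚ
halfPow (suc k) = ½ * halfPow k

-- Distribution of h = min(L, ĥ), ĥ ~ Geom(1/2) on {1,2,...}, as a finite list
-- of (value, probability) pairs:
--   L = 0      : h = 0 with probability 1
--   L ≥ 1      : P(h = k) = (1/2)^k for 1 ≤ k < L, P(h = L) = Σ_{k ≥ L} (1/2)^k = (1/2)^(L-1)
geomTail : ℕ → ℕ → List (ℕ × ℚ)
-- geomTail k r : entries for h = k, k+1, ..., with r further values before reaching L
geomTail k zero = (k , halfPow (k ∸ 1)) ∷ []
geomTail k (suc r) = (k , halfPow k) ∷ geomTail (suc k) r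

truncGeomDist : ℕ → List (ℕ × ℚ)
truncGeomDist zero = (0 , 1ℚ) ∷ []
truncGeomDist (suc l) = geomTail 1 l

expectList : List (ℕ × ℚ) → (ℕ → ℚ) → ℚ
expectList [] g = 0ℚ
expectList ((k , p) ∷ d) g = p * g k + expectList d g

expectIID : {A : Set} → ((A → ℚ) → ℚ) → (m : ℕ) → ((Fin m → A) → ℚ) → ℚ
expectIID e zero f = f (λ ())
expectIID e (suc m) f = e (λ a → expectIID e m (λ g → f (a VF.∷ g)))

anyFin : {m : ℕ} → (Fin m → Bool) → Bool
anyFin {zero} p = false
anyFin {suc m} p = p zero ∨ anyFin (λ i → p (suc i))

countFin : {m : ℕ} → (Fin m → Bool) → ℕ
countFin {zero} p = 0
countFin {suc m} p = (if p zero then 1 else 0) Data.Nat.+ countFin (λ i → p (suc i))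

firstFin : {m : ℕ} → (Fin m → Bool) → Maybe (Fin m)
firstFin {zero} p = nothing
firstFin {suc m} p with p zero
... | true = just zero
... | false with firstFin (λ i → p (suc i))
...   | just i = just (suc i)
...   | nothing = nothing

_=ᶠ_ : {m : ℕ} → Fin m → Fin m → Bool
a =ᶠ b = toℕ a ≡ᵇ toℕ b

-- One invocation of Protocol(nil, 1) at a fixed time step (all n nodes participate).
-- val i : observed value of node i; h i : its (truncated geometric) draw.
roundOf : {n : ℕ} → (Fin n → ℕ) → Fin n → ℕ
roundOf {n} h i = logN n ∸ h i

broadcasts : {n Δ : ℕ} → (Fin n → Fin Δ) → (Fin n → ℕ) → Fin n → Bool
broadcasts val h i =
  not (anyFin (λ i' → (val i' =ᶠ val i) ∧ (roundOf h i' <ᵇ roundOf h i)))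

-- messages of one invocation: each node broadcast = single-cast + server broadcast = 2 messages
protocolCost : {n Δ : ℕ} → (Fin n → Fin Δ) → (Fin n → ℕ) → ℕ
protocolCost val h = 2 Data.Nat.* countFin (broadcasts val h)

-- server output: representative j_v = the smallest-ID node that broadcast v (nil = nothing)
serverR : {n Δ : ℕ} → (Fin n → Fin Δ) → (Fin n → ℕ) → Fin Δ → Maybe (Fin n)
serverR val h v = firstFin (λ i → broadcasts val h i ∧ (val i =ᶠ v))

serverD : {n Δ : ℕ} → (Fin n → Fin Δ) → (Fin n → ℕ) → Fin Δ → Bool
serverD val h v = is-just (serverR val h v)

domainSize : {n Δ : ℕ} → (Fin n → Fin Δ) → ℕ
domainSize {Δ = Δ} val = countFin {Δ} (λ v → anyFin (λ i → val i =ᶠ v))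

totalCost : {n Δ T : ℕ} → (Fin T → Fin n → Fin Δ) → (Fin T → Fin n → ℕ) → ℕ
totalCost {T = zero} val h = 0
totalCost {T = suc T} val h =
  protocolCost (val zero) (h zero) Data.Nat.+ totalCost (λ t → val (suc t)) (λ t → h (suc t))

sumDomains : {n Δ T : ℕ} → (Fin T → Fin n → Fin Δ) → ℕ
sumDomains {T = zero} val = 0
sumDomains {T = suc T} val = domainSize (val zero) Data.Nat.+ sumDomains (λ t → val (suc t))

expectedCost : {n Δ T : ℕ} → (Fin T → Fin n → Fin Δ) → ℚ
expectedCost {n} {Δ} {T} val =
  expectIID (expectIID (expectList (truncGeomDist (logN n))) n) T
    (λ h → ((Data.Integer.+ totalCost val h) Data.Rational./ 1))

InSupport : ℕ → ℕ → Set
InSupport L k = Data.List.Membership.Propositional._∈_ k (Data.List.map Data.Product.proj₁ (truncGeomDist L))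

-- Correctness: for every value v that occurs, the node of value v with the earliest round is suppressed by
-- nobody, so the server receives v; every received value is the value of its sender.
--
-- Cost: a node broadcasts iff its height is maximal among the c nodes sharing its value, so the expected number
-- of broadcasts for that value is the expected number of maxima among c independent truncated geometric
-- heights, c · ∑ₛ P(s) F(s)^(c-1) with P the mass function and F the distribution function. Below the cap L we
-- have P(s) ≤ 2 P(s+1), which by Bernoulli's inequality bounds the s-th term by twice the increment
-- F(s+1)^c − F(s)^c; these telescope to at most 2, and the last term c · P(L) is at most 2 because
-- c ≤ n ≤ 2^L. So every value present costs between 2 and 8 messages in expectation.
module Submission where

open import Algebra.Bundles using (CommutativeMonoid; CommutativeRing)
open import Data.Bool using (Bool; true; false; _∧_; _∨_; not; if_then_else_; T)
open import Data.Bool.Properties using (not-involutive; T-≡)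
open import Data.Empty using (⊥-elim)
open import Data.Fin using (Fin; zero; suc; toℕ)
import Data.Fin.Properties as Finₚ
open import Data.Integer using (+_)
import Data.Integer as ℤ
import Data.Integer.Properties as ℤₚ
open import Data.List using (List; []; _∷_)
open import Data.List.Relation.Unary.All using (All; []; _∷_)
open import Data.Maybe using (just; nothing)
open import Data.Nat as ℕ using (ℕ; zero; suc; _∸_; _<ᵇ_; _≡ᵇ_)
import Data.Nat.Coprimality as Coprime
import Data.Nat.Properties as ℕₚ
open import Data.Product using (_×_; ∃; Σ; _,_)
open import Data.Rational as ℚ using (ℚ; 0ℚ; 1ℚ; ½; _+_; _*_; _/_; _<_)
import Data.Rational.Properties as ℚₚ
open import Data.Rational.Solver using (module +-*-Solver)
import Data.Rational.Unnormalised as ℚᵘ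
import Data.Rational.Unnormalised.Properties as ℚᵘₚ
open import Data.Unit using (tt)
import Data.Vec.Functional as Vec
open import Function using (_∘_; Equivalence)
open import Relation.Binary.Definitions using (tri<; tri≈; tri>)
open import Relation.Binary.PropositionalEquality
open import Relation.Nullary using (¬_; yes; no)

open import Algebra.Definitions.RawSemiring ℚ.+-*-rawSemiring using (_^_)
open import Algebra.Properties.Monoid.Sum (CommutativeMonoid.monoid ℚₚ.*-1-commutativeMonoid)
  using () renaming (sum to product; sum-cong-≗ to product-cong-≗)
open import Algebra.Properties.Semiring.Sum (CommutativeRing.semiring ℚₚ.+-*-commutativeRing)
  using (sum; sum-syntax; sum-cong-≗; sum-replicate-zero; ∑-comm; *-distribˡ-sum; *-distribʳ-sum)

open import Defs

module Boolean where

  true-of : ∀ {b} → T b → b ≡ true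
  true-of = Equivalence.to T-≡

  false-of : ∀ {b} → ¬ T b → b ≡ false
  false-of {false} _ = refl
  false-of {true} ¬t = ⊥-elim (¬t tt)

  ∧-true : ∀ {a b} → (a ∧ b) ≡ true → (a ≡ true) × (b ≡ true)
  ∧-true {true} {true} _ = refl , refl

  ≡ᵇ-true : ∀ {m n} → m ≡ n → (m ≡ᵇ n) ≡ true
  ≡ᵇ-true {m} refl = true-of (ℕₚ.≡⇒≡ᵇ m m refl)

  ≡ᵇ-false : ∀ {m n} → m ≢ n → (m ≡ᵇ n) ≡ false
  ≡ᵇ-false {m} {n} m≢n = false-of (m≢n ∘ ℕₚ.≡ᵇ⇒≡ m n)

  <ᵇ-true : ∀ {m n} → m ℕ.< n → (m <ᵇ n) ≡ true
  <ᵇ-true m<n = true-of (ℕₚ.<⇒<ᵇ m<n)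

  <ᵇ-false : ∀ {m n} → ¬ m ℕ.< n → (m <ᵇ n) ≡ false
  <ᵇ-false {m} {n} m≮n = false-of (m≮n ∘ ℕₚ.<ᵇ⇒< m n)

  <ᵇ-sound : ∀ {m n} → (m <ᵇ n) ≡ true → m ℕ.< n
  <ᵇ-sound {m} {n} m<ᵇn = ℕₚ.<ᵇ⇒< m n (Equivalence.from T-≡ m<ᵇn)

  =ᶠ-sound : ∀ {m} {a b : Fin m} → (a =ᶠ b) ≡ true → a ≡ b
  =ᶠ-sound {a = a} {b} a=b = Finₚ.toℕ-injective (ℕₚ.≡ᵇ⇒≡ (toℕ a) (toℕ b) (Equivalence.from T-≡ a=b))

  =ᶠ-refl : ∀ {m} (a : Fin m) → (a =ᶠ a) ≡ true
  =ᶠ-refl a = ≡ᵇ-true {toℕ a} refl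

  =ᶠ-complete : ∀ {m} {a b : Fin m} → a ≡ b → (a =ᶠ b) ≡ true
  =ᶠ-complete {a = a} refl = =ᶠ-refl a

  anyFin-sound : ∀ {m} (p : Fin m → Bool) → anyFin p ≡ true → ∃ λ i → p i ≡ true
  anyFin-sound {suc m} p some with p zero in p₀
  ... | true = zero , p₀
  ... | false with i , pᵢ ← anyFin-sound (p ∘ suc) some = suc i , pᵢ

  anyFin-complete : ∀ {m} (p : Fin m → Bool) i → p i ≡ true → anyFin p ≡ true
  anyFin-complete p zero pᵢ rewrite pᵢ = refl
  anyFin-complete p (suc i) pᵢ rewrite anyFin-complete (p ∘ suc) i pᵢ with p zero
  ... | true = refl
  ... | false = refl

  anyFin-cong : ∀ {m} {p q : Fin m → Bool} → (∀ i → p i ≡ q i) → anyFin p ≡ anyFin q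
  anyFin-cong {zero} p≗q = refl
  anyFin-cong {suc m} p≗q = cong₂ _∨_ (p≗q zero) (anyFin-cong (p≗q ∘ suc))

  firstFin-sound : ∀ {m} (p : Fin m → Bool) {j} → firstFin p ≡ just j → p j ≡ true
  firstFin-sound {suc m} p first with p zero in p₀
  firstFin-sound {suc m} p refl | true = p₀
  ... | false with firstFin (p ∘ suc) in first′
  firstFin-sound {suc m} p refl | false | just i = firstFin-sound (p ∘ suc) first′

  firstFin-complete : ∀ {m} (p : Fin m → Bool) j → p j ≡ true → ∃ λ k → firstFin p ≡ just k
  firstFin-complete {suc m} p j pⱼ with p zero in p₀
  ... | true = zero , refl
  ... | false with firstFin (p ∘ suc) in first
  ...   | just i = suc i , refl
  firstFin-complete {suc m} p zero pⱼ | false | nothing with () ← trans (sym pⱼ) p₀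
  firstFin-complete {suc m} p (suc j) pⱼ | false | nothing
    with k , first′ ← firstFin-complete (p ∘ suc) j pⱼ
    with () ← trans (sym first) first′

  countFin-≤ : ∀ {m} (p : Fin m → Bool) → countFin p ℕ.≤ m
  countFin-≤ {zero} p = ℕ.z≤n
  countFin-≤ {suc m} p with p zero
  ... | true = ℕ.s≤s (countFin-≤ (p ∘ suc))
  ... | false = ℕₚ.m≤n⇒m≤1+n (countFin-≤ (p ∘ suc))

  countFin-none : ∀ {m} (p : Fin m → Bool) → anyFin p ≡ false → countFin p ≡ 0
  countFin-none {zero} p _ = refl
  countFin-none {suc m} p none with p zero
  countFin-none {suc m} p () | true
  ... | false = countFin-none (p ∘ suc) none

  countFin-remove : ∀ {m} (p : Fin m → Bool) i → p i ≡ true →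
                    countFin p ≡ suc (countFin (λ j → not (j =ᶠ i) ∧ p j))
  countFin-remove {suc m} p zero pᵢ rewrite pᵢ = refl
  countFin-remove {suc m} p (suc i) pᵢ rewrite countFin-remove (p ∘ suc) i pᵢ with p zero
  ... | true = refl
  ... | false = refl

module Expectation where

  open import Data.Rational using (_≤_)

  2ℚ : ℚ
  2ℚ = 1ℚ + 1ℚ

  *-nonNeg : ∀ {p q} → 0ℚ ≤ p → 0ℚ ≤ q → 0ℚ ≤ p * q
  *-nonNeg {p} {q} 0≤p 0≤q = ℚₚ.nonNegative⁻¹ (p * q)
    {{ℚₚ.nonNeg*nonNeg⇒nonNeg p {{ℚ.nonNegative 0≤p}} q {{ℚ.nonNegative 0≤q}}}}

  *-monoʳ-≤ : ∀ {r p q} → 0ℚ ≤ r → p ≤ q → r * p ≤ r * q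
  *-monoʳ-≤ {r} 0≤r = ℚₚ.*-monoˡ-≤-nonNeg r {{ℚ.nonNegative 0≤r}}

  p≤p+q : ∀ {p q} → 0ℚ ≤ q → p ≤ p + q
  p≤p+q {p} {q} 0≤q = subst (_≤ p + q) (ℚₚ.+-identityʳ p) (ℚₚ.+-monoʳ-≤ p 0≤q)

  toℚ : ℕ → ℚ
  toℚ n = + n / 1

  toℚ-mkℚ : ∀ n → toℚ n ≡ ℚ.mkℚ (+ n) 0 (Coprime.sym (Coprime.1-coprimeTo n))
  toℚ-mkℚ n = ℚₚ.normalize-coprime (Coprime.sym (Coprime.1-coprimeTo n))

  toℚ-+ : ∀ m n → toℚ (m ℕ.+ n) ≡ toℚ m + toℚ n
  toℚ-+ m n =
    ℚₚ.toℚᵘ-injective (ℚᵘₚ.≃-trans unnormalised (ℚᵘₚ.≃-sym (ℚₚ.toℚᵘ-homo-+ (toℚ m) (toℚ n))))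
    where
    open ≡-Reasoning
    unnormalised : ℚ.toℚᵘ (toℚ (m ℕ.+ n)) ℚᵘ.≃ ℚ.toℚᵘ (toℚ m) ℚᵘ.+ ℚ.toℚᵘ (toℚ n)
    unnormalised rewrite toℚ-mkℚ (m ℕ.+ n) | toℚ-mkℚ m | toℚ-mkℚ n = ℚᵘ.*≡* (begin
      + (m ℕ.+ n) ℤ.* + 1                    ≡⟨ ℤₚ.*-identityʳ _ ⟩
      + m ℤ.+ + n                            ≡⟨ cong₂ ℤ._+_ (ℤₚ.*-identityʳ (+ m)) (ℤₚ.*-identityʳ (+ n)) ⟨
      + m ℤ.* + 1 ℤ.+ + n ℤ.* + 1            ≡⟨ ℤₚ.*-identityʳ _ ⟨
      (+ m ℤ.* + 1 ℤ.+ + n ℤ.* + 1) ℤ.* + 1  ∎)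

  toℚ-nonNeg : ∀ n → 0ℚ ≤ toℚ n
  toℚ-nonNeg n = ℚₚ.nonNegative⁻¹ (toℚ n) {{ℚₚ.normalize-nonNeg n 1}}

  toℚ-mono-≤ : ∀ {m n} → m ℕ.≤ n → toℚ m ≤ toℚ n
  toℚ-mono-≤ {m} m≤n with k , refl ← ℕₚ.m≤n⇒∃[o]m+o≡n m≤n rewrite toℚ-+ m k = p≤p+q (toℚ-nonNeg k)

  toℚ-2* : ∀ n → toℚ (2 ℕ.* n) ≡ 2ℚ * toℚ n
  toℚ-2* n = begin
    toℚ (n ℕ.+ (n ℕ.+ 0))    ≡⟨ cong (λ m → toℚ (n ℕ.+ m)) (ℕₚ.+-identityʳ n) ⟩
    toℚ (n ℕ.+ n)            ≡⟨ toℚ-+ n n ⟩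
    toℚ n + toℚ n            ≡⟨ cong₂ _+_ (ℚₚ.*-identityˡ (toℚ n)) (ℚₚ.*-identityˡ (toℚ n)) ⟨
    1ℚ * toℚ n + 1ℚ * toℚ n  ≡⟨ ℚₚ.*-distribʳ-+ (toℚ n) 1ℚ 1ℚ ⟨
    2ℚ * toℚ n               ∎
    where open ≡-Reasoning

  𝟙 : Bool → ℚ
  𝟙 true = 1ℚ
  𝟙 false = 0ℚ

  𝟙-nonNeg : ∀ b → 0ℚ ≤ 𝟙 b
  𝟙-nonNeg true = ℚₚ.nonNegative⁻¹ 1ℚ
  𝟙-nonNeg false = ℚₚ.≤-refl

  toℚ-countFin : ∀ {m} (p : Fin m → Bool) → toℚ (countFin p) ≡ ∑[ i < m ] 𝟙 (p i)
  toℚ-countFin {zero} p = refl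
  toℚ-countFin {suc m} p =
    trans (toℚ-+ (if p zero then 1 else 0) _) (cong₂ _+_ (toℚ-if (p zero)) (toℚ-countFin (p ∘ suc)))
    where
    toℚ-if : ∀ b → toℚ (if b then 1 else 0) ≡ 𝟙 b
    toℚ-if true = refl
    toℚ-if false = refl

  ∑-mono-≤ : ∀ {m} {f g : Fin m → ℚ} → (∀ i → f i ≤ g i) → sum f ≤ sum g
  ∑-mono-≤ {zero} f≤g = ℚₚ.≤-refl
  ∑-mono-≤ {suc m} f≤g = ℚₚ.+-mono-≤ (f≤g zero) (∑-mono-≤ (f≤g ∘ suc))

  ∑-nonNeg : ∀ {m} (f : Fin m → ℚ) → (∀ i → 0ℚ ≤ f i) → 0ℚ ≤ sum f
  ∑-nonNeg {m} f 0≤f = subst (_≤ sum f) (sum-replicate-zero m) (∑-mono-≤ 0≤f)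

  term≤∑ : ∀ {m} (f : Fin m → ℚ) → (∀ i → 0ℚ ≤ f i) → ∀ j → f j ≤ sum f
  term≤∑ f 0≤f zero = p≤p+q (∑-nonNeg (f ∘ suc) (0≤f ∘ suc))
  term≤∑ f 0≤f (suc j) = subst (_≤ f zero + sum (f ∘ suc)) (ℚₚ.+-identityˡ (f (suc j)))
                               (ℚₚ.+-mono-≤ (0≤f zero) (term≤∑ (f ∘ suc) (0≤f ∘ suc) j))

  ∑-𝟙-=ᶠ : ∀ {m} (w : Fin m) → ∑[ v < m ] 𝟙 (w =ᶠ v) ≡ 1ℚ
  ∑-𝟙-=ᶠ {suc m} zero rewrite sum-replicate-zero m = refl
  ∑-𝟙-=ᶠ {suc m} (suc w) rewrite ∑-𝟙-=ᶠ w = refl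

  ∑-groupBy : ∀ {n Δ} (val : Fin n → Fin Δ) (f : Fin n → ℚ) →
              ∑[ i < n ] f i ≡ ∑[ v < Δ ] ∑[ i < n ] (𝟙 (val i =ᶠ v) * f i)
  ∑-groupBy {n} {Δ} val f = begin
    ∑[ i < n ] f i                                  ≡⟨ sum-cong-≗ one-value ⟨
    ∑[ i < n ] ((∑[ v < Δ ] 𝟙 (val i =ᶠ v)) * f i)  ≡⟨ sum-cong-≗ (λ i → *-distribʳ-sum (f i) (𝟙 ∘ (val i =ᶠ_))) ⟩
    ∑[ i < n ] ∑[ v < Δ ] (𝟙 (val i =ᶠ v) * f i)    ≡⟨ ∑-comm (λ i v → 𝟙 (val i =ᶠ v) * f i) ⟩
    ∑[ v < Δ ] ∑[ i < n ] (𝟙 (val i =ᶠ v) * f i)    ∎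
    where
    open ≡-Reasoning
    one-value : ∀ i → (∑[ v < Δ ] 𝟙 (val i =ᶠ v)) * f i ≡ f i
    one-value i = trans (cong (_* f i) (∑-𝟙-=ᶠ (val i))) (ℚₚ.*-identityˡ (f i))

  sumBelow : ℕ → (ℕ → ℚ) → ℚ
  sumBelow zero f = 0ℚ
  sumBelow (suc N) f = sumBelow N f + f N

  sumBelow-cong : ∀ N {f g : ℕ → ℚ} → (∀ s → s ℕ.< N → f s ≡ g s) → sumBelow N f ≡ sumBelow N g
  sumBelow-cong zero f≗g = refl
  sumBelow-cong (suc N) f≗g =
    cong₂ _+_ (sumBelow-cong N (λ s s<N → f≗g s (ℕₚ.m<n⇒m<1+n s<N))) (f≗g N ℕₚ.≤-refl)

  sumBelow-nonNeg : ∀ N (f : ℕ → ℚ) → (∀ s → 0ℚ ≤ f s) → 0ℚ ≤ sumBelow N f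
  sumBelow-nonNeg zero f 0≤f = ℚₚ.≤-refl
  sumBelow-nonNeg (suc N) f 0≤f = ℚₚ.+-mono-≤ (sumBelow-nonNeg N f 0≤f) (0≤f N)

  *-distribˡ-sumBelow : ∀ c (f : ℕ → ℚ) N → c * sumBelow N f ≡ sumBelow N (λ s → c * f s)
  *-distribˡ-sumBelow c f zero = ℚₚ.*-zeroʳ c
  *-distribˡ-sumBelow c f (suc N) =
    trans (ℚₚ.*-distribˡ-+ c (sumBelow N f) (f N)) (cong (_+ c * f N) (*-distribˡ-sumBelow c f N))

  sumBelow-zero : ∀ N (f : ℕ → ℚ) → (∀ s → s ℕ.< N → f s ≡ 0ℚ) → sumBelow N f ≡ 0ℚ
  sumBelow-zero zero f _ = refl
  sumBelow-zero (suc N) f f≡0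
    rewrite sumBelow-zero N f (λ s s<N → f≡0 s (ℕₚ.m<n⇒m<1+n s<N)) | f≡0 N ℕₚ.≤-refl = refl

  sumBelow-single : ∀ N (f : ℕ → ℚ) x → x ℕ.< N → (∀ s → s ≢ x → f s ≡ 0ℚ) → sumBelow N f ≡ f x
  sumBelow-single (suc N) f x x<1+N f≡0 with x ℕₚ.≟ N
  ... | yes refl =
    trans (cong (_+ f x) (sumBelow-zero N f (λ s s<x → f≡0 s (ℕₚ.<⇒≢ s<x)))) (ℚₚ.+-identityˡ (f x))
  ... | no x≢N =
    trans (cong (λ y → sumBelow N f + y) (f≡0 N (x≢N ∘ sym)))
          (trans (ℚₚ.+-identityʳ _) (sumBelow-single N f x (ℕₚ.≤∧≢⇒< (ℕₚ.≤-pred x<1+N) x≢N) f≡0))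

  -- 𝔼 only inspects its argument on S, which therefore over-approximates the support.
  record IsExpectation {A : Set} (S : A → Set) (𝔼 : (A → ℚ) → ℚ) : Set where
    field
      mono-≤ : ∀ {f g} → (∀ a → S a → f a ≤ g a) → 𝔼 f ≤ 𝔼 g
      +-homo : ∀ f g → 𝔼 (λ a → f a + g a) ≡ 𝔼 f + 𝔼 g
      *-homo : ∀ c f → 𝔼 (λ a → c * f a) ≡ c * 𝔼 f
      1-homo : 𝔼 (λ _ → 1ℚ) ≡ 1ℚ

    cong-on : ∀ {f g} → (∀ a → S a → f a ≡ g a) → 𝔼 f ≡ 𝔼 g
    cong-on f≗g = ℚₚ.≤-antisym (mono-≤ (λ a s → ℚₚ.≤-reflexive (f≗g a s)))
                               (mono-≤ (λ a s → ℚₚ.≤-reflexive (sym (f≗g a s))))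

    const : ∀ c → 𝔼 (λ _ → c) ≡ c
    const c = begin
      𝔼 (λ _ → c)       ≡⟨ cong-on (λ _ _ → ℚₚ.*-identityʳ c) ⟨
      𝔼 (λ _ → c * 1ℚ)  ≡⟨ *-homo c (λ _ → 1ℚ) ⟩
      c * 𝔼 (λ _ → 1ℚ)  ≡⟨ cong (c *_) 1-homo ⟩
      c * 1ℚ            ≡⟨ ℚₚ.*-identityʳ c ⟩
      c                 ∎
      where open ≡-Reasoning

    *-homoʳ : ∀ c f → 𝔼 (λ a → f a * c) ≡ 𝔼 f * c
    *-homoʳ c f = trans (cong-on (λ a _ → ℚₚ.*-comm (f a) c)) (trans (*-homo c f) (ℚₚ.*-comm c (𝔼 f)))

    const≤ : ∀ {f} c → (∀ a → S a → c ≤ f a) → c ≤ 𝔼 f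
    const≤ {f} c c≤f = subst (_≤ 𝔼 f) (const c) (mono-≤ c≤f)

    ∑-homo : ∀ {m} (F : Fin m → A → ℚ) → 𝔼 (λ a → ∑[ i < m ] F i a) ≡ ∑[ i < m ] 𝔼 (F i)
    ∑-homo {zero} F = const 0ℚ
    ∑-homo {suc m} F = trans (+-homo (F zero) _) (cong (λ y → 𝔼 (F zero) + y) (∑-homo (F ∘ suc)))

    sumBelow-homo : ∀ (F : ℕ → A → ℚ) N →
                    𝔼 (λ a → sumBelow N (λ s → F s a)) ≡ sumBelow N (λ s → 𝔼 (F s))
    sumBelow-homo F zero = const 0ℚ
    sumBelow-homo F (suc N) = trans (+-homo _ (F N)) (cong (_+ 𝔼 (F N)) (sumBelow-homo F N))

  open IsExpectation

  WeightsOn : ℕ → List (ℕ × ℚ) → Set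
  WeightsOn L = All (λ (k , p) → k ℕ.≤ L × 0ℚ ≤ p)

  mass : List (ℕ × ℚ) → ℚ
  mass [] = 0ℚ
  mass ((k , p) ∷ d) = p + mass d

  expectList-isExpectation : ∀ {L} d → WeightsOn L d → mass d ≡ 1ℚ →
                             IsExpectation (ℕ._≤ L) (expectList d)
  expectList-isExpectation {L} d weights total = record
    { mono-≤ = mono d weights
    ; +-homo = additive d
    ; *-homo = homogeneous d
    ; 1-homo = trans (normalised d) total
    }
    where
    open +-*-Solver
    mono : ∀ d → WeightsOn L d → ∀ {f g} → (∀ a → a ℕ.≤ L → f a ≤ g a) →
           expectList d f ≤ expectList d g
    mono [] [] f≤g = ℚₚ.≤-refl
    mono ((k , p) ∷ d) ((k≤L , 0≤p) ∷ weights) f≤g =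
      ℚₚ.+-mono-≤ (*-monoʳ-≤ 0≤p (f≤g k k≤L)) (mono d weights f≤g)
    additive : ∀ d f g → expectList d (λ a → f a + g a) ≡ expectList d f + expectList d g
    additive [] f g = refl
    additive ((k , p) ∷ d) f g rewrite additive d f g =
      solve 5 (λ p x y u v → p :* (x :+ y) :+ (u :+ v) := (p :* x :+ u) :+ (p :* y :+ v))
        refl p (f k) (g k) (expectList d f) (expectList d g)
    homogeneous : ∀ d c f → expectList d (λ a → c * f a) ≡ c * expectList d f
    homogeneous [] c f = sym (ℚₚ.*-zeroʳ c)
    homogeneous ((k , p) ∷ d) c f rewrite homogeneous d c f =
      solve 4 (λ p c x u → p :* (c :* x) :+ c :* u := c :* (p :* x :+ u)) refl p c (f k) (expectList d f)
    normalised : ∀ d → expectList d (λ _ → 1ℚ) ≡ mass d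
    normalised [] = refl
    normalised ((k , p) ∷ d) = cong₂ _+_ (ℚₚ.*-identityʳ p) (normalised d)

  expectIID-isExpectation : ∀ {A : Set} {S : A → Set} {e : (A → ℚ) → ℚ} → IsExpectation S e →
                            ∀ m → IsExpectation (λ h → ∀ j → S (h j)) (expectIID e m)
  expectIID-isExpectation 𝔼 zero = record
    { mono-≤ = λ f≤g → f≤g (λ ()) (λ ())
    ; +-homo = λ _ _ → refl
    ; *-homo = λ _ _ → refl
    ; 1-homo = refl
    }
  expectIID-isExpectation {A} {S} {e} 𝔼 (suc m) = record
    { mono-≤ = λ f≤g → mono-≤ 𝔼 (λ a Sa → mono-≤ 𝔼ₘ (λ h Sh → f≤g (a Vec.∷ h) (cons Sa Sh)))
    ; +-homo = λ f g →
        trans (cong-on 𝔼 (λ a _ → +-homo 𝔼ₘ (f ∘ (a Vec.∷_)) (g ∘ (a Vec.∷_)))) (+-homo 𝔼 _ _)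
    ; *-homo = λ c f → trans (cong-on 𝔼 (λ a _ → *-homo 𝔼ₘ c (f ∘ (a Vec.∷_)))) (*-homo 𝔼 c _)
    ; 1-homo = trans (cong-on 𝔼 (λ _ _ → 1-homo 𝔼ₘ)) (1-homo 𝔼)
    }
    where
    𝔼ₘ : IsExpectation (λ h → ∀ j → S (h j)) (expectIID e m)
    𝔼ₘ = expectIID-isExpectation 𝔼 m
    cons : ∀ {a : A} {h : Fin m → A} → S a → (∀ j → S (h j)) → ∀ j → S ((a Vec.∷ h) j)
    cons Sa Sh zero = Sa
    cons Sa Sh (suc j) = Sh j

  expectIID-product : ∀ {A : Set} {S : A → Set} {e : (A → ℚ) → ℚ} → IsExpectation S e →
                      ∀ m (φ : Fin m → A → ℚ) →
                      expectIID e m (λ h → product (λ j → φ j (h j))) ≡ product (λ j → e (φ j))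
  expectIID-product 𝔼 zero φ = refl
  expectIID-product {e = e} 𝔼 (suc m) φ = begin
    e (λ a → expectIID e m (λ h → φ zero a * product (λ j → φ (suc j) (h j))))
      ≡⟨ cong-on 𝔼 (λ a _ → *-homo (expectIID-isExpectation 𝔼 m) (φ zero a) _) ⟩
    e (λ a → φ zero a * expectIID e m (λ h → product (λ j → φ (suc j) (h j))))
      ≡⟨ cong-on 𝔼 (λ a _ → cong (φ zero a *_) (expectIID-product 𝔼 m (φ ∘ suc))) ⟩
    e (λ a → φ zero a * product (λ j → e (φ (suc j))))
      ≡⟨ *-homoʳ 𝔼 _ (φ zero) ⟩
    e (φ zero) * product (λ j → e (φ (suc j)))
      ∎
    where open ≡-Reasoning

  product-𝟙 : ∀ {m} (b : Fin m → Bool) → product (𝟙 ∘ b) ≡ 𝟙 (not (anyFin (not ∘ b)))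
  product-𝟙 {zero} b = refl
  product-𝟙 {suc m} b with b zero
  ... | true = trans (ℚₚ.*-identityˡ _) (product-𝟙 (b ∘ suc))
  ... | false = ℚₚ.*-zeroˡ (product (𝟙 ∘ b ∘ suc))

  product-if-^ : ∀ {m} c (b : Fin m → Bool) → product (λ j → if b j then c else 1ℚ) ≡ c ^ countFin b
  product-if-^ {zero} c b = refl
  product-if-^ {suc m} c b with b zero
  ... | true = cong (c *_) (product-if-^ c (b ∘ suc))
  ... | false = trans (ℚₚ.*-identityˡ _) (product-if-^ c (b ∘ suc))

  product-pick-^ : ∀ {m} (i : Fin m) a c (b : Fin m → Bool) →
                   product (λ j → if j =ᶠ i then a else (if b j then c else 1ℚ))
                   ≡ a * c ^ countFin (λ j → not (j =ᶠ i) ∧ b j)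
  product-pick-^ {suc m} zero a c b = cong (a *_) (product-if-^ c (b ∘ suc))
  product-pick-^ {suc m} (suc i) a c b with b zero
  ... | true = trans (cong (c *_) (product-pick-^ i a c (b ∘ suc))) (x*[y*z]≡y*[x*z] c a _)
    where
    x*[y*z]≡y*[x*z] : ∀ x y z → x * (y * z) ≡ y * (x * z)
    x*[y*z]≡y*[x*z] = solve 3 (λ x y z → x :* (y :* z) := y :* (x :* z)) refl
      where open +-*-Solver
  ... | false = trans (ℚₚ.*-identityˡ _) (product-pick-^ i a c (b ∘ suc))

module Maxima where

  open import Data.Rational using (_≤_)
  open Expectation
  open +-*-Solver

  ^-nonNeg : ∀ {p} k → 0ℚ ≤ p → 0ℚ ≤ p ^ k
  ^-nonNeg zero _ = ℚₚ.nonNegative⁻¹ 1ℚ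
  ^-nonNeg (suc k) 0≤p = *-nonNeg 0≤p (^-nonNeg k 0≤p)

  1^k≡1 : ∀ k → 1ℚ ^ k ≡ 1ℚ
  1^k≡1 zero = refl
  1^k≡1 (suc k) = trans (ℚₚ.*-identityˡ (1ℚ ^ k)) (1^k≡1 k)

  bernoulli : ∀ {b d} → 0ℚ ≤ b → 0ℚ ≤ d → ∀ k →
              b ^ suc k + toℚ (suc k) * (d * b ^ k) ≤ (b + d) ^ suc k
  bernoulli {b} {d} 0≤b 0≤d zero = ℚₚ.≤-reflexive
    (solve 2 (λ b d → b :* con 1ℚ :+ con 1ℚ :* (d :* con 1ℚ) := (b :+ d) :* con 1ℚ) refl b d)
  bernoulli {b} {d} 0≤b 0≤d (suc k) = begin
    b * (b * B) + toℚ (suc (suc k)) * (d * (b * B))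
      ≡⟨ cong (λ x → b * (b * B) + x * (d * (b * B))) (toℚ-+ 1 (suc k)) ⟩
    b * (b * B) + (1ℚ + c) * (d * (b * B))
      ≤⟨ p≤p+q (*-nonNeg (*-nonNeg (*-nonNeg (toℚ-nonNeg (suc k)) 0≤d) 0≤d) (^-nonNeg k 0≤b)) ⟩
    b * (b * B) + (1ℚ + c) * (d * (b * B)) + c * d * d * B
      ≡⟨ solve 4 (λ b d c B → b :* (b :* B) :+ (con 1ℚ :+ c) :* (d :* (b :* B)) :+ c :* d :* d :* B
                             := (b :+ d) :* (b :* B :+ c :* (d :* B))) refl b d c B ⟩
    (b + d) * (b ^ suc k + c * (d * B))
      ≤⟨ *-monoʳ-≤ (ℚₚ.+-mono-≤ 0≤b 0≤d) (bernoulli 0≤b 0≤d k) ⟩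
    (b + d) * (b + d) ^ suc k
      ∎
    where
    open ℚₚ.≤-Reasoning
    B = b ^ k
    c = toℚ (suc k)

  -- For a distribution P on {0, …, L} with distribution function F, (k+1) · ∑ₛ P(s) · F(s)^k is the expected
  -- number of draws attaining the maximum among k+1 independent draws from P.
  module _ (P : ℕ → ℚ) (L k : ℕ)
           (P-nonNeg : ∀ s → 0ℚ ≤ P s)
           (P-halving : ∀ s → s ℕ.< L → P s ≤ 2ℚ * P (suc s))
           (P-total : sumBelow (suc L) P ≡ 1ℚ)
           (P-last : toℚ (suc k) * P L ≤ 2ℚ) where

    F : ℕ → ℚ
    F s = sumBelow (suc s) P

    F-nonNeg : ∀ s → 0ℚ ≤ F s
    F-nonNeg s = sumBelow-nonNeg (suc s) P P-nonNeg

    summand : ℕ → ℚ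
    summand s = toℚ (suc k) * (P s * F s ^ k)

    summand≤increment : ∀ s → s ℕ.< L → 2ℚ * F s ^ suc k + summand s ≤ 2ℚ * F (suc s) ^ suc k
    summand≤increment s s<L = begin
      2ℚ * F s ^ suc k + c * (P s * F s ^ k)
        ≤⟨ ℚₚ.+-monoʳ-≤ (2ℚ * F s ^ suc k) (*-monoʳ-≤ (toℚ-nonNeg (suc k)) P[s]F[s]^k≤) ⟩
      2ℚ * F s ^ suc k + c * (2ℚ * P (suc s) * F s ^ k)
        ≡⟨ solve 4 (λ x c d y → two :* x :+ c :* (two :* d :* y) := two :* (x :+ c :* (d :* y)))
             refl (F s ^ suc k) c (P (suc s)) (F s ^ k) ⟩
      2ℚ * (F s ^ suc k + c * (P (suc s) * F s ^ k))
        ≤⟨ *-monoʳ-≤ (ℚₚ.nonNegative⁻¹ 2ℚ) (bernoulli (F-nonNeg s) (P-nonNeg (suc s)) k) ⟩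
      2ℚ * F (suc s) ^ suc k
        ∎
      where
      open ℚₚ.≤-Reasoning
      c = toℚ (suc k)
      two = con 1ℚ :+ con 1ℚ
      P[s]F[s]^k≤ : P s * F s ^ k ≤ 2ℚ * P (suc s) * F s ^ k
      P[s]F[s]^k≤ = ℚₚ.*-monoʳ-≤-nonNeg (F s ^ k) {{ℚ.nonNegative (^-nonNeg k (F-nonNeg s))}} (P-halving s s<L)

    telescope : ∀ N → N ℕ.≤ L → sumBelow N summand + 2ℚ * F 0 ^ suc k ≤ 2ℚ * F N ^ suc k
    telescope zero _ = ℚₚ.≤-reflexive (ℚₚ.+-identityˡ _)
    telescope (suc N) N<L = begin
      sumBelow N summand + summand N + X  ≡⟨ solve 3 (λ a t x → a :+ t :+ x := a :+ x :+ t)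
                                               refl (sumBelow N summand) (summand N) X ⟩
      sumBelow N summand + X + summand N  ≤⟨ ℚₚ.+-monoˡ-≤ (summand N) (telescope N (ℕₚ.<⇒≤ N<L)) ⟩
      2ℚ * F N ^ suc k + summand N        ≤⟨ summand≤increment N N<L ⟩
      2ℚ * F (suc N) ^ suc k              ∎
      where
      open ℚₚ.≤-Reasoning
      X = 2ℚ * F 0 ^ suc k

    expectedMaxima≤4 : toℚ (suc k) * sumBelow (suc L) (λ s → P s * F s ^ k) ≤ 2ℚ + 2ℚ
    expectedMaxima≤4 = begin
      toℚ (suc k) * sumBelow (suc L) (λ s → P s * F s ^ k)  ≡⟨ *-distribˡ-sumBelow (toℚ (suc k)) _ (suc L) ⟩
      sumBelow L summand + summand L                        ≤⟨ ℚₚ.+-mono-≤ telescoped last ⟩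
      2ℚ + 2ℚ                                               ∎
      where
      open ℚₚ.≤-Reasoning
      F[L]^ : ∀ j → F L ^ j ≡ 1ℚ
      F[L]^ j = trans (cong (_^ j) P-total) (1^k≡1 j)
      telescoped : sumBelow L summand ≤ 2ℚ
      telescoped = begin
        sumBelow L summand                     ≤⟨ p≤p+q (*-nonNeg (ℚₚ.nonNegative⁻¹ 2ℚ) (^-nonNeg (suc k) (F-nonNeg 0))) ⟩
        sumBelow L summand + 2ℚ * F 0 ^ suc k  ≤⟨ telescope L ℕₚ.≤-refl ⟩
        2ℚ * F L ^ suc k                       ≡⟨ cong (2ℚ *_) (F[L]^ (suc k)) ⟩
        2ℚ * 1ℚ                                ≡⟨ ℚₚ.*-identityʳ 2ℚ ⟩
        2ℚ                                     ∎
      last : summand L ≤ 2ℚ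
      last = begin
        toℚ (suc k) * (P L * F L ^ k)  ≡⟨ cong (λ x → toℚ (suc k) * (P L * x)) (F[L]^ k) ⟩
        toℚ (suc k) * (P L * 1ℚ)       ≡⟨ cong (toℚ (suc k) *_) (ℚₚ.*-identityʳ (P L)) ⟩
        toℚ (suc k) * P L              ≤⟨ P-last ⟩
        2ℚ                             ∎

module TruncatedGeometric where

  open import Data.Rational using (_≤_)
  open Boolean
  open Expectation
  open IsExpectation

  halfPow-nonNeg : ∀ k → 0ℚ ≤ halfPow k
  halfPow-nonNeg zero = ℚₚ.nonNegative⁻¹ 1ℚ
  halfPow-nonNeg (suc k) = *-nonNeg (ℚₚ.nonNegative⁻¹ ½) (halfPow-nonNeg k)

  ½*p+½*p : ∀ p → ½ * p + ½ * p ≡ p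
  ½*p+½*p p = trans (sym (ℚₚ.*-distribʳ-+ p ½ ½)) (ℚₚ.*-identityˡ p)

  2*½*p : ∀ p → 2ℚ * (½ * p) ≡ p
  2*½*p p = trans (sym (ℚₚ.*-assoc 2ℚ ½ p)) (ℚₚ.*-identityˡ p)

  2^k*halfPow : ∀ k → toℚ (2 ℕ.^ k) * halfPow k ≡ 1ℚ
  2^k*halfPow zero = refl
  2^k*halfPow (suc k) = begin
    toℚ (2 ℕ.* 2 ℕ.^ k) * (½ * halfPow k)   ≡⟨ cong (_* (½ * halfPow k)) (toℚ-2* (2 ℕ.^ k)) ⟩
    2ℚ * toℚ (2 ℕ.^ k) * (½ * halfPow k)    ≡⟨ solve 3 (λ t a h → two :* t :* (a :* h) := two :* (a :* (t :* h)))
                                                 refl (toℚ (2 ℕ.^ k)) ½ (halfPow k) ⟩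
    2ℚ * (½ * (toℚ (2 ℕ.^ k) * halfPow k))  ≡⟨ 2*½*p _ ⟩
    toℚ (2 ℕ.^ k) * halfPow k               ≡⟨ 2^k*halfPow k ⟩
    1ℚ                                      ∎
    where
    open ≡-Reasoning
    open +-*-Solver
    two = con 1ℚ :+ con 1ℚ

  geomTail-weights : ∀ {L} k r → k ℕ.+ r ℕ.≤ L → WeightsOn L (geomTail k r)
  geomTail-weights {L} k zero k+0≤L = (subst (ℕ._≤ L) (ℕₚ.+-identityʳ k) k+0≤L , halfPow-nonNeg (k ∸ 1)) ∷ []
  geomTail-weights {L} k (suc r) k+1+r≤L =
    (ℕₚ.≤-trans (ℕₚ.m≤m+n k (suc r)) k+1+r≤L , halfPow-nonNeg k)
    ∷ geomTail-weights (suc k) r (subst (ℕ._≤ L) (ℕₚ.+-suc k r) k+1+r≤L)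

  geomTail-mass : ∀ k r → mass (geomTail (suc k) r) ≡ halfPow k
  geomTail-mass k zero = ℚₚ.+-identityʳ (halfPow k)
  geomTail-mass k (suc r) = trans (cong (λ p → ½ * halfPow k + p) (geomTail-mass (suc k) r)) (½*p+½*p (halfPow k))

  truncGeom-isExpectation : ∀ L → IsExpectation (ℕ._≤ L) (expectList (truncGeomDist L))
  truncGeom-isExpectation zero = expectList-isExpectation _ ((ℕₚ.≤-refl , ℚₚ.nonNegative⁻¹ 1ℚ) ∷ []) refl
  truncGeom-isExpectation (suc l) = expectList-isExpectation _ (geomTail-weights 1 l ℕₚ.≤-refl) (geomTail-mass 0 l)

  pmfTail : ℕ → ℕ → ℕ → ℚ
  pmfTail k r s = expectList (geomTail k r) (λ x → 𝟙 (x ≡ᵇ s))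

  pmfTail-below : ∀ k r s → s ℕ.< k → pmfTail k r s ≡ 0ℚ
  pmfTail-below k zero s s<k rewrite ≡ᵇ-false (ℕₚ.>⇒≢ s<k) =
    trans (ℚₚ.+-identityʳ _) (ℚₚ.*-zeroʳ (halfPow (k ∸ 1)))
  pmfTail-below k (suc r) s s<k
    rewrite ≡ᵇ-false (ℕₚ.>⇒≢ s<k) | pmfTail-below (suc k) r s (ℕₚ.m<n⇒m<1+n s<k) =
    trans (ℚₚ.+-identityʳ _) (ℚₚ.*-zeroʳ (halfPow k))

  pmfTail-inner : ∀ k r s → k ℕ.≤ s → s ℕ.< k ℕ.+ r → pmfTail k r s ≡ halfPow s
  pmfTail-inner k zero s k≤s s<k+0 =
    ⊥-elim (ℕₚ.<⇒≱ s<k+0 (subst (ℕ._≤ s) (sym (ℕₚ.+-identityʳ k)) k≤s))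
  pmfTail-inner k (suc r) s k≤s s<k+1+r with k ℕₚ.≟ s
  ... | yes refl rewrite ≡ᵇ-true (refl {x = k}) | pmfTail-below (suc k) r k ℕₚ.≤-refl =
    trans (ℚₚ.+-identityʳ _) (ℚₚ.*-identityʳ (halfPow k))
  ... | no k≢s
    rewrite ≡ᵇ-false k≢s
          | pmfTail-inner (suc k) r s (ℕₚ.≤∧≢⇒< k≤s k≢s) (subst (s ℕ.<_) (ℕₚ.+-suc k r) s<k+1+r) =
    trans (cong (_+ halfPow s) (ℚₚ.*-zeroʳ (halfPow k))) (ℚₚ.+-identityˡ (halfPow s))

  pmfTail-last : ∀ k r → pmfTail k r (k ℕ.+ r) ≡ halfPow (k ℕ.+ r ∸ 1)
  pmfTail-last k zero rewrite ℕₚ.+-identityʳ k | ≡ᵇ-true (refl {x = k}) =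
    trans (ℚₚ.+-identityʳ _) (ℚₚ.*-identityʳ (halfPow (k ∸ 1)))
  pmfTail-last k (suc r) rewrite ℕₚ.+-suc k r | ≡ᵇ-false (ℕₚ.<⇒≢ (ℕ.s≤s (ℕₚ.m≤m+n k r))) =
    trans (cong (_+ pmfTail (suc k) r (suc (k ℕ.+ r))) (ℚₚ.*-zeroʳ (halfPow k)))
          (trans (ℚₚ.+-identityˡ _) (pmfTail-last (suc k) r))

  pmf : ℕ → ℕ → ℚ
  pmf L s = expectList (truncGeomDist L) (λ x → 𝟙 (x ≡ᵇ s))

  cdf : ℕ → ℕ → ℚ
  cdf L s = sumBelow (suc s) (pmf L)

  pmf-nonNeg : ∀ L s → 0ℚ ≤ pmf L s
  pmf-nonNeg L s = const≤ (truncGeom-isExpectation L) 0ℚ (λ x _ → 𝟙-nonNeg (x ≡ᵇ s))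

  pmf-halving : ∀ L s → s ℕ.< L → pmf L s ≤ 2ℚ * pmf L (suc s)
  pmf-halving (suc l) zero _ rewrite pmfTail-below 1 l 0 ℕₚ.≤-refl =
    *-nonNeg (ℚₚ.nonNegative⁻¹ 2ℚ) (pmf-nonNeg (suc l) 1)
  pmf-halving (suc l) (suc s) s<L with suc (suc s) ℕₚ.<? suc l
  ... | yes 2+s<L
    rewrite pmfTail-inner 1 l (suc s) (ℕ.s≤s ℕ.z≤n) s<L | pmfTail-inner 1 l (suc (suc s)) (ℕ.s≤s ℕ.z≤n) 2+s<L =
    ℚₚ.≤-reflexive (sym (2*½*p (halfPow (suc s))))
  ... | no 2+s≮L with refl ← ℕₚ.≤-antisym s<L (ℕₚ.≮⇒≥ 2+s≮L)
    rewrite pmfTail-inner 1 (suc s) (suc s) (ℕ.s≤s ℕ.z≤n) s<L | pmfTail-last 1 (suc s) =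
    subst (_≤ 2ℚ * halfPow (suc s)) (ℚₚ.*-identityˡ (halfPow (suc s)))
      (ℚₚ.*-monoʳ-≤-nonNeg (halfPow (suc s)) {{ℚ.nonNegative (halfPow-nonNeg (suc s))}} 1≤2)
    where
    1≤2 : 1ℚ ≤ 2ℚ
    1≤2 = p≤p+q (ℚₚ.nonNegative⁻¹ 1ℚ)

  2^L*pmf-last : ∀ L → toℚ (2 ℕ.^ L) * pmf L L ≤ 2ℚ
  2^L*pmf-last zero = p≤p+q (ℚₚ.nonNegative⁻¹ 1ℚ)
  2^L*pmf-last (suc l) rewrite pmfTail-last 1 l = ℚₚ.≤-reflexive (begin
    toℚ (2 ℕ.* 2 ℕ.^ l) * halfPow l   ≡⟨ cong (_* halfPow l) (toℚ-2* (2 ℕ.^ l)) ⟩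
    2ℚ * toℚ (2 ℕ.^ l) * halfPow l    ≡⟨ ℚₚ.*-assoc 2ℚ (toℚ (2 ℕ.^ l)) (halfPow l) ⟩
    2ℚ * (toℚ (2 ℕ.^ l) * halfPow l)  ≡⟨ cong (2ℚ *_) (2^k*halfPow l) ⟩
    2ℚ * 1ℚ                           ≡⟨ ℚₚ.*-identityʳ 2ℚ ⟩
    2ℚ                                ∎)
    where open ≡-Reasoning

  sumBelow-𝟙-≡ᵇ : ∀ x N → sumBelow N (λ t → 𝟙 (x ≡ᵇ t)) ≡ 𝟙 (x <ᵇ N)
  sumBelow-𝟙-≡ᵇ x zero = refl
  sumBelow-𝟙-≡ᵇ x (suc N) rewrite sumBelow-𝟙-≡ᵇ x N with ℕₚ.<-cmp x N
  ... | tri< x<N x≢N _ rewrite <ᵇ-true x<N | ≡ᵇ-false x≢N | <ᵇ-true (ℕₚ.m<n⇒m<1+n x<N) =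
    ℚₚ.+-identityʳ 1ℚ
  ... | tri≈ x≮N refl _ rewrite <ᵇ-false x≮N | ≡ᵇ-true (refl {x = x}) | <ᵇ-true (ℕₚ.n<1+n x) = refl
  ... | tri> x≮N x≢N N<x rewrite <ᵇ-false x≮N | ≡ᵇ-false x≢N | <ᵇ-false (ℕₚ.<⇒≱ N<x ∘ ℕₚ.≤-pred) =
    refl

  expect-≤≡cdf : ∀ L s → expectList (truncGeomDist L) (λ x → 𝟙 (x <ᵇ suc s)) ≡ cdf L s
  expect-≤≡cdf L s = trans (cong-on 𝔼 (λ x _ → sym (sumBelow-𝟙-≡ᵇ x (suc s))))
                           (sumBelow-homo 𝔼 (λ t x → 𝟙 (x ≡ᵇ t)) (suc s))
    where
    𝔼 : IsExpectation (ℕ._≤ L) (expectList (truncGeomDist L))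
    𝔼 = truncGeom-isExpectation L

  cdf-last : ∀ L → cdf L L ≡ 1ℚ
  cdf-last L = begin
    cdf L L                                               ≡⟨ expect-≤≡cdf L L ⟨
    expectList (truncGeomDist L) (λ x → 𝟙 (x <ᵇ suc L))  ≡⟨ cong-on 𝔼 (λ _ x≤L → cong 𝟙 (<ᵇ-true (ℕ.s≤s x≤L))) ⟩
    expectList (truncGeomDist L) (λ _ → 1ℚ)               ≡⟨ 1-homo 𝔼 ⟩
    1ℚ                                                    ∎
    where
    open ≡-Reasoning
    𝔼 : IsExpectation (ℕ._≤ L) (expectList (truncGeomDist L))
    𝔼 = truncGeom-isExpectation L

module Logarithm where

  open import Data.Nat using (⌈_/2⌉)
  open import Data.Nat.Logarithm.Core using (⌈log2⌉)
  open import Data.Nat.Induction using (<-wellFounded)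
  open import Induction.WellFounded using (Acc; acc)

  n≤2^⌈log2⌉ : ∀ n (rec : Acc ℕ._<_ n) → n ℕ.≤ 2 ℕ.^ ⌈log2⌉ n rec
  n≤2^⌈log2⌉ zero _ = ℕ.z≤n
  n≤2^⌈log2⌉ (suc zero) _ = ℕₚ.≤-refl
  n≤2^⌈log2⌉ (suc (suc n)) (acc rs) = begin
    suc (suc n)                      ≤⟨ ℕ.s≤s (ℕ.s≤s n≤⌈n/2⌉+⌈n/2⌉) ⟩
    suc (suc (⌈ n /2⌉ ℕ.+ ⌈ n /2⌉))  ≡⟨ cong suc (ℕₚ.+-suc ⌈ n /2⌉ ⌈ n /2⌉) ⟨
    suc ⌈ n /2⌉ ℕ.+ suc ⌈ n /2⌉      ≤⟨ ℕₚ.+-mono-≤ ih ih ⟩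
    2 ℕ.^ m ℕ.+ 2 ℕ.^ m              ≡⟨ cong (2 ℕ.^ m ℕ.+_) (ℕₚ.+-identityʳ (2 ℕ.^ m)) ⟨
    2 ℕ.^ suc m                      ∎
    where
    open ℕₚ.≤-Reasoning
    m : ℕ
    m = ⌈log2⌉ (suc ⌈ n /2⌉) (rs (ℕₚ.⌈n/2⌉<n n))
    ih : suc ⌈ n /2⌉ ℕ.≤ 2 ℕ.^ m
    ih = n≤2^⌈log2⌉ (suc ⌈ n /2⌉) (rs (ℕₚ.⌈n/2⌉<n n))
    n≤⌈n/2⌉+⌈n/2⌉ : n ℕ.≤ ⌈ n /2⌉ ℕ.+ ⌈ n /2⌉
    n≤⌈n/2⌉+⌈n/2⌉ = subst (ℕ._≤ ⌈ n /2⌉ ℕ.+ ⌈ n /2⌉) (ℕₚ.⌊n/2⌋+⌈n/2⌉≡n n)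
                          (ℕₚ.+-monoˡ-≤ ⌈ n /2⌉ (ℕₚ.⌊n/2⌋≤⌈n/2⌉ n))

  n≤2^logN : ∀ n → n ℕ.≤ 2 ℕ.^ logN n
  n≤2^logN n = n≤2^⌈log2⌉ n (<-wellFounded n)

module Domain {n Δ : ℕ} (val : Fin n → Fin Δ) where

  open import Data.Rational using (_≤_)
  open Boolean
  open Expectation

  present : Fin Δ → Bool
  present v = anyFin (λ i → val i =ᶠ v)

  multiplicity : Fin Δ → ℕ
  multiplicity v = countFin (λ j → val j =ᶠ v)

  others : Fin n → ℕ
  others i = countFin (λ j → not (j =ᶠ i) ∧ (val j =ᶠ val i))

  others≡multiplicity∸1 : ∀ i → others i ≡ multiplicity (val i) ∸ 1
  others≡multiplicity∸1 i = cong (_∸ 1) (sym (countFin-remove (λ j → val j =ᶠ val i) i (=ᶠ-refl (val i))))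

  domainSize≤∑ : (b : Fin n → Bool) →
                 (∀ v → present v ≡ true → ∃ λ j → (b j ∧ (val j =ᶠ v)) ≡ true) →
                 toℚ (domainSize val) ≤ ∑[ i < n ] 𝟙 (b i)
  domainSize≤∑ b covers = begin
    toℚ (domainSize val)                              ≡⟨ toℚ-countFin present ⟩
    ∑[ v < Δ ] 𝟙 (present v)                          ≤⟨ ∑-mono-≤ present≤ ⟩
    ∑[ v < Δ ] ∑[ i < n ] (𝟙 (val i =ᶠ v) * 𝟙 (b i))  ≡⟨ ∑-groupBy val (𝟙 ∘ b) ⟨
    ∑[ i < n ] 𝟙 (b i)                                ∎
    where
    open ℚₚ.≤-Reasoning
    term-nonNeg : ∀ v i → 0ℚ ≤ 𝟙 (val i =ᶠ v) * 𝟙 (b i)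
    term-nonNeg v i = *-nonNeg (𝟙-nonNeg (val i =ᶠ v)) (𝟙-nonNeg (b i))
    present≤ : ∀ v → 𝟙 (present v) ≤ ∑[ i < n ] (𝟙 (val i =ᶠ v) * 𝟙 (b i))
    present≤ v with present v in isPresent
    ... | false = ∑-nonNeg _ (term-nonNeg v)
    ... | true with j , bⱼ∧vⱼ ← covers v isPresent with bⱼ , vⱼ ← ∧-true {b j} bⱼ∧vⱼ =
      subst (_≤ ∑[ i < n ] (𝟙 (val i =ᶠ v) * 𝟙 (b i))) (cong₂ (λ x y → 𝟙 x * 𝟙 y) vⱼ bⱼ)
            (term≤∑ _ (term-nonNeg v) j)

  ∑-others≤ : (g : ℕ → ℚ) (K : ℚ) → 0ℚ ≤ K → (∀ k → suc k ℕ.≤ n → toℚ (suc k) * g k ≤ K) →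
              ∑[ i < n ] g (others i) ≤ K * toℚ (domainSize val)
  ∑-others≤ g K 0≤K bound = begin
    ∑[ i < n ] g (others i)                                          ≡⟨ ∑-groupBy val (g ∘ others) ⟩
    ∑[ v < Δ ] ∑[ i < n ] (𝟙 (val i =ᶠ v) * g (others i))            ≡⟨ sum-cong-≗ (sum-cong-≗ ∘ by-value) ⟩
    ∑[ v < Δ ] ∑[ i < n ] (𝟙 (val i =ᶠ v) * g (multiplicity v ∸ 1))  ≡⟨ sum-cong-≗ per-value-sum ⟩
    ∑[ v < Δ ] (toℚ (multiplicity v) * g (multiplicity v ∸ 1))       ≤⟨ ∑-mono-≤ per-value ⟩
    ∑[ v < Δ ] (K * 𝟙 (present v))                                   ≡⟨ *-distribˡ-sum K (𝟙 ∘ present) ⟨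
    K * ∑[ v < Δ ] 𝟙 (present v)                                     ≡⟨ cong (K *_) (toℚ-countFin present) ⟨
    K * toℚ (domainSize val)                                         ∎
    where
    open ℚₚ.≤-Reasoning
    by-value : ∀ v i → 𝟙 (val i =ᶠ v) * g (others i) ≡ 𝟙 (val i =ᶠ v) * g (multiplicity v ∸ 1)
    by-value v i with val i =ᶠ v in vᵢ=v
    ... | true = cong (λ k → 1ℚ * g k)
                      (trans (others≡multiplicity∸1 i) (cong (λ w → multiplicity w ∸ 1) (=ᶠ-sound vᵢ=v)))
    ... | false = trans (ℚₚ.*-zeroˡ (g (others i))) (sym (ℚₚ.*-zeroˡ (g (multiplicity v ∸ 1))))
    per-value-sum : ∀ v → ∑[ i < n ] (𝟙 (val i =ᶠ v) * g (multiplicity v ∸ 1))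
                          ≡ toℚ (multiplicity v) * g (multiplicity v ∸ 1)
    per-value-sum v = trans (sym (*-distribʳ-sum (g (multiplicity v ∸ 1)) (λ i → 𝟙 (val i =ᶠ v))))
                            (cong (_* g (multiplicity v ∸ 1)) (sym (toℚ-countFin (λ i → val i =ᶠ v))))
    per-value : ∀ v → toℚ (multiplicity v) * g (multiplicity v ∸ 1) ≤ K * 𝟙 (present v)
    per-value v with present v in isPresent
    ... | false rewrite countFin-none (λ j → val j =ᶠ v) isPresent | ℚₚ.*-zeroʳ K =
      ℚₚ.≤-reflexive (ℚₚ.*-zeroˡ (g 0))
    ... | true with i , vᵢ ← anyFin-sound (λ i → val i =ᶠ v) isPresent
      rewrite countFin-remove (λ j → val j =ᶠ v) i vᵢ | ℚₚ.*-identityʳ K =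
      bound _ (subst (ℕ._≤ n) (countFin-remove (λ j → val j =ᶠ v) i vᵢ) (countFin-≤ (λ j → val j =ᶠ v)))

module Correctness where

  open Boolean

  -- k is fuel bounding f i: each recursive call moves to a node with strictly smaller f.
  minimal-exists : ∀ {n} (q : Fin n → Bool) (f : Fin n → ℕ) k i → q i ≡ true → f i ℕ.≤ k →
                   ∃ λ j → q j ≡ true × anyFin (λ j′ → q j′ ∧ (f j′ <ᵇ f j)) ≡ false
  minimal-exists q f k i qᵢ fᵢ≤k with anyFin (λ j′ → q j′ ∧ (f j′ <ᵇ f i)) in smaller
  ... | false = i , qᵢ , smaller
  ... | true with j , qⱼ∧fⱼ<fᵢ ← anyFin-sound (λ j′ → q j′ ∧ (f j′ <ᵇ f i)) smaller
             with qⱼ , fⱼ<fᵢ ← ∧-true {q j} qⱼ∧fⱼ<fᵢ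
             with k | ℕₚ.<-≤-trans (<ᵇ-sound fⱼ<fᵢ) fᵢ≤k
  ... | suc k′ | fⱼ<1+k′ = minimal-exists q f k′ j qⱼ (ℕₚ.≤-pred fⱼ<1+k′)

  broadcaster-exists : ∀ {n Δ} (val : Fin n → Fin Δ) (h : Fin n → ℕ) v →
                       (∃ λ i → val i ≡ v) → ∃ λ j → (broadcasts val h j ∧ (val j =ᶠ v)) ≡ true
  broadcaster-exists val h v (i , vᵢ≡v)
    with j , vⱼ , none-earlier ←
           minimal-exists (λ j → val j =ᶠ v) (roundOf h) _ i (=ᶠ-complete vᵢ≡v) ℕₚ.≤-refl
    with refl ← =ᶠ-sound {a = val j} {b = v} vⱼ
    = j , cong₂ _∧_ (cong not none-earlier) vⱼ

  serverOutput-correct : ∀ {n Δ} (val : Fin n → Fin Δ) (h : Fin n → ℕ) (v : Fin Δ) →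
    ((serverD val h v ≡ true → ∃ λ i → val i ≡ v)
     × ((∃ λ i → val i ≡ v) → serverD val h v ≡ true)
     × ((j : Fin n) → serverR val h v ≡ just j → val j ≡ v)
     × (serverR val h v ≡ nothing → ¬ (∃ λ i → val i ≡ v)))
  serverOutput-correct {n} val h v = D-sound , D-complete , R-sound , R-complete
    where
    received : Fin n → Bool
    received i = broadcasts val h i ∧ (val i =ᶠ v)
    R-sound : ∀ j → serverR val h v ≡ just j → val j ≡ v
    R-sound j Rᵥ with _ , vⱼ ← ∧-true {broadcasts val h j} (firstFin-sound received Rᵥ) = =ᶠ-sound vⱼ
    D-sound : serverD val h v ≡ true → ∃ λ i → val i ≡ v
    D-sound _ with serverR val h v in Rᵥ
    ... | just j = j , R-sound j Rᵥ
    some-received : (∃ λ i → val i ≡ v) → ∃ λ k → serverR val h v ≡ just k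
    some-received occurs with j , rⱼ ← broadcaster-exists val h v occurs = firstFin-complete received j rⱼ
    D-complete : (∃ λ i → val i ≡ v) → serverD val h v ≡ true
    D-complete occurs with _ , Rᵥ ← some-received occurs rewrite Rᵥ = refl
    R-complete : serverR val h v ≡ nothing → ¬ (∃ λ i → val i ≡ v)
    R-complete Rᵥ occurs with _ , Rᵥ′ ← some-received occurs with () ← trans (sym Rᵥ) Rᵥ′

module Invocation {n Δ : ℕ} (val : Fin n → Fin Δ) where

  open import Data.Rational using (_≤_)
  open Boolean
  open Expectation
  open IsExpectation
  open TruncatedGeometric
  open Domain val
  open Correctness

  L : ℕ
  L = logN n

  draw : (ℕ → ℚ) → ℚ
  draw = expectList (truncGeomDist L)

  𝔼-draw : IsExpectation (ℕ._≤ L) draw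
  𝔼-draw = truncGeom-isExpectation L

  E : ((Fin n → ℕ) → ℚ) → ℚ
  E = expectIID draw n

  𝔼-E : IsExpectation (λ h → ∀ j → h j ℕ.≤ L) E
  𝔼-E = expectIID-isExpectation 𝔼-draw n

  not-earlier≡≤ : ∀ {x s} → x ℕ.≤ L → s ℕ.≤ L → not (L ∸ x <ᵇ L ∸ s) ≡ (x <ᵇ suc s)
  not-earlier≡≤ {x} {s} x≤L s≤L with x ℕₚ.≤? s
  ... | yes x≤s rewrite <ᵇ-false (ℕₚ.≤⇒≯ (ℕₚ.∸-monoʳ-≤ L x≤s)) | <ᵇ-true (ℕ.s≤s x≤s) = refl
  ... | no x≰s rewrite <ᵇ-true (ℕₚ.∸-monoʳ-< (ℕₚ.≰⇒> x≰s) x≤L) | <ᵇ-false (x≰s ∘ ℕₚ.≤-pred) =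
    refl

  notEarlier : ℕ → ℚ
  notEarlier s = draw (λ x → 𝟙 (not (L ∸ x <ᵇ L ∸ s)))

  notEarlier≡cdf : ∀ s → s ℕ.≤ L → notEarlier s ≡ cdf L s
  notEarlier≡cdf s s≤L =
    trans (cong-on 𝔼-draw (λ _ x≤L → cong 𝟙 (not-earlier≡≤ x≤L s≤L))) (expect-≤≡cdf L s)

  -- Node i broadcasts iff, for s = h i, every factor i s j (h j) holds: i drew s and no node with the value
  -- of i drew a larger height, i.e. got an earlier round.
  factor : Fin n → ℕ → Fin n → ℕ → Bool
  factor i s j x = if j =ᶠ i then x ≡ᵇ s else not ((val j =ᶠ val i) ∧ (L ∸ x <ᵇ L ∸ s))

  𝟙-broadcasts : ∀ h i → (∀ j → h j ℕ.≤ L) →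
                 𝟙 (broadcasts val h i) ≡ sumBelow (suc L) (λ s → product (λ j → 𝟙 (factor i s j (h j))))
  𝟙-broadcasts h i h≤L = sym (begin
    sumBelow (suc L) (λ s → product (λ j → 𝟙 (factor i s j (h j))))
      ≡⟨ sumBelow-cong (suc L) (λ s _ → product-𝟙 (λ j → factor i s j (h j))) ⟩
    sumBelow (suc L) all-factors
      ≡⟨ sumBelow-single (suc L) all-factors (h i) (ℕ.s≤s (h≤L i)) other-heights ⟩
    all-factors (h i)
      ≡⟨ cong (𝟙 ∘ not) (anyFin-cong not-factor) ⟩
    𝟙 (broadcasts val h i)
      ∎)
    where
    open ≡-Reasoning
    all-factors : ℕ → ℚ
    all-factors s = 𝟙 (not (anyFin (λ j → not (factor i s j (h j)))))
    other-heights : ∀ s → s ≢ h i → all-factors s ≡ 0ℚ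
    other-heights s s≢hᵢ = cong (𝟙 ∘ not) (anyFin-complete (λ j → not (factor i s j (h j))) i i-fails)
      where
      i-fails : not (factor i s i (h i)) ≡ true
      i-fails rewrite =ᶠ-refl i | ≡ᵇ-false (s≢hᵢ ∘ sym) = refl
    not-factor : ∀ j → not (factor i (h i) j (h j)) ≡ ((val j =ᶠ val i) ∧ (L ∸ h j <ᵇ L ∸ h i))
    not-factor j with j =ᶠ i in j=i
    ... | false = not-involutive _
    ... | true with refl ← =ᶠ-sound {a = j} {b = i} j=i
      rewrite ≡ᵇ-true (refl {x = h j}) | =ᶠ-refl (val j) | <ᵇ-false (ℕₚ.<-irrefl (refl {x = L ∸ h j})) = refl

  draw-factor : ∀ i s j →
                draw (𝟙 ∘ factor i s j)
                ≡ (if j =ᶠ i then pmf L s else (if val j =ᶠ val i then notEarlier s else 1ℚ))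
  draw-factor i s j with j =ᶠ i
  ... | true = refl
  ... | false with val j =ᶠ val i
  ...   | true = refl
  ...   | false = 1-homo 𝔼-draw

  maximumProbability : ℕ → ℚ
  maximumProbability k = sumBelow (suc L) (λ s → pmf L s * cdf L s ^ k)

  broadcast-probability : ∀ i → E (λ h → 𝟙 (broadcasts val h i)) ≡ maximumProbability (others i)
  broadcast-probability i = begin
    E (λ h → 𝟙 (broadcasts val h i))
      ≡⟨ cong-on 𝔼-E (λ h h≤L → 𝟙-broadcasts h i h≤L) ⟩
    E (λ h → sumBelow (suc L) (λ s → product (λ j → 𝟙 (factor i s j (h j)))))
      ≡⟨ sumBelow-homo 𝔼-E (λ s h → product (λ j → 𝟙 (factor i s j (h j)))) (suc L) ⟩
    sumBelow (suc L) (λ s → E (λ h → product (λ j → 𝟙 (factor i s j (h j)))))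
      ≡⟨ sumBelow-cong (suc L) (λ s s<1+L → at-height s (ℕₚ.≤-pred s<1+L)) ⟩
    maximumProbability (others i)
      ∎
    where
    open ≡-Reasoning
    at-height : ∀ s → s ℕ.≤ L →
                E (λ h → product (λ j → 𝟙 (factor i s j (h j)))) ≡ pmf L s * cdf L s ^ others i
    at-height s s≤L = begin
      E (λ h → product (λ j → 𝟙 (factor i s j (h j))))
        ≡⟨ expectIID-product 𝔼-draw n (λ j → 𝟙 ∘ factor i s j) ⟩
      product (λ j → draw (𝟙 ∘ factor i s j))
        ≡⟨ product-cong-≗ (draw-factor i s) ⟩
      product (λ j → if j =ᶠ i then pmf L s else (if val j =ᶠ val i then notEarlier s else 1ℚ))
        ≡⟨ product-pick-^ i (pmf L s) (notEarlier s) (λ j → val j =ᶠ val i) ⟩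
      pmf L s * notEarlier s ^ others i
        ≡⟨ cong (λ p → pmf L s * p ^ others i) (notEarlier≡cdf s s≤L) ⟩
      pmf L s * cdf L s ^ others i
        ∎

  maximumProbability-bound : ∀ k → suc k ℕ.≤ n → toℚ (suc k) * maximumProbability k ≤ 2ℚ + 2ℚ
  maximumProbability-bound k k<n =
    Maxima.expectedMaxima≤4 (pmf L) L k (pmf-nonNeg L) (pmf-halving L) (cdf-last L) (begin
      toℚ (suc k) * pmf L L    ≤⟨ ℚₚ.*-monoʳ-≤-nonNeg (pmf L L) {{ℚ.nonNegative (pmf-nonNeg L L)}}
                                    (toℚ-mono-≤ (ℕₚ.≤-trans k<n (Logarithm.n≤2^logN n))) ⟩
      toℚ (2 ℕ.^ L) * pmf L L  ≤⟨ 2^L*pmf-last L ⟩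
      2ℚ                       ∎)
    where open ℚₚ.≤-Reasoning

  expectedBroadcasts≤ : E (λ h → toℚ (countFin (broadcasts val h))) ≤ (2ℚ + 2ℚ) * toℚ (domainSize val)
  expectedBroadcasts≤ = begin
    E (λ h → toℚ (countFin (broadcasts val h)))  ≡⟨ cong-on 𝔼-E (λ h _ → toℚ-countFin (broadcasts val h)) ⟩
    E (λ h → ∑[ i < n ] 𝟙 (broadcasts val h i))  ≡⟨ ∑-homo 𝔼-E (λ i h → 𝟙 (broadcasts val h i)) ⟩
    ∑[ i < n ] E (λ h → 𝟙 (broadcasts val h i))  ≡⟨ sum-cong-≗ broadcast-probability ⟩
    ∑[ i < n ] maximumProbability (others i)     ≤⟨ ∑-others≤ maximumProbability _ 0≤4 maximumProbability-bound ⟩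
    (2ℚ + 2ℚ) * toℚ (domainSize val)             ∎
    where
    open ℚₚ.≤-Reasoning
    0≤4 : 0ℚ ≤ 2ℚ + 2ℚ
    0≤4 = ℚₚ.nonNegative⁻¹ (2ℚ + 2ℚ)

  expectedProtocolCost≤ : E (λ h → toℚ (protocolCost val h)) ≤ 2ℚ * (2ℚ + 2ℚ) * toℚ (domainSize val)
  expectedProtocolCost≤ = begin
    E (λ h → toℚ (protocolCost val h))       ≡⟨ cong-on 𝔼-E (λ h _ → toℚ-2* (countFin (broadcasts val h))) ⟩
    E (λ h → 2ℚ * broadcasts# h)             ≡⟨ *-homo 𝔼-E 2ℚ broadcasts# ⟩
    2ℚ * E broadcasts#                       ≤⟨ *-monoʳ-≤ (ℚₚ.nonNegative⁻¹ 2ℚ) expectedBroadcasts≤ ⟩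
    2ℚ * ((2ℚ + 2ℚ) * toℚ (domainSize val))  ≡⟨ ℚₚ.*-assoc 2ℚ (2ℚ + 2ℚ) (toℚ (domainSize val)) ⟨
    2ℚ * (2ℚ + 2ℚ) * toℚ (domainSize val)    ∎
    where
    open ℚₚ.≤-Reasoning
    broadcasts# : (Fin n → ℕ) → ℚ
    broadcasts# h = toℚ (countFin (broadcasts val h))

  protocolCost≥ : ∀ h → 2ℚ * toℚ (domainSize val) ≤ toℚ (protocolCost val h)
  protocolCost≥ h = begin
    2ℚ * toℚ (domainSize val)               ≤⟨ *-monoʳ-≤ (ℚₚ.nonNegative⁻¹ 2ℚ) (domainSize≤∑ _ covered) ⟩
    2ℚ * ∑[ i < n ] 𝟙 (broadcasts val h i)  ≡⟨ cong (2ℚ *_) (toℚ-countFin (broadcasts val h)) ⟨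
    2ℚ * toℚ (countFin (broadcasts val h))  ≡⟨ toℚ-2* (countFin (broadcasts val h)) ⟨
    toℚ (protocolCost val h)                ∎
    where
    open ℚₚ.≤-Reasoning
    covered : ∀ v → present v ≡ true → ∃ λ j → (broadcasts val h j ∧ (val j =ᶠ v)) ≡ true
    covered v isPresent with i , vᵢ ← anyFin-sound (λ i → val i =ᶠ v) isPresent =
      broadcaster-exists val h v (i , =ᶠ-sound vᵢ)

  expectedProtocolCost≥ : 2ℚ * toℚ (domainSize val) ≤ E (λ h → toℚ (protocolCost val h))
  expectedProtocolCost≥ = const≤ 𝔼-E _ (λ h _ → protocolCost≥ h)

module Cost {n Δ : ℕ} where

  open import Data.Rational using (_≤_)
  open Expectation
  open IsExpectation
  open Invocation using (E; 𝔼-E)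

  expectedCost≡∑ : ∀ T (val : Fin T → Fin n → Fin Δ) →
                   expectedCost val ≡ ∑[ t < T ] E (val t) (λ h → toℚ (protocolCost (val t) h))
  expectedCost≡∑ zero val = refl
  expectedCost≡∑ (suc T) val = begin
    E₀ (λ h → expectIID E₀ T (λ g → toℚ (cost₀ h ℕ.+ totalCost (val ∘ suc) g)))
      ≡⟨ cong-on 𝔼₀ (λ h _ → later-steps h) ⟩
    E₀ (λ h → toℚ (cost₀ h) + expectedCost (val ∘ suc))
      ≡⟨ +-homo 𝔼₀ _ _ ⟩
    E₀ (toℚ ∘ cost₀) + E₀ (λ _ → expectedCost (val ∘ suc))
      ≡⟨ cong (λ x → E₀ (toℚ ∘ cost₀) + x) (trans (const 𝔼₀ _) (expectedCost≡∑ T (val ∘ suc))) ⟩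
    ∑[ t < suc T ] E (val t) (λ h → toℚ (protocolCost (val t) h))
      ∎
    where
    open ≡-Reasoning
    E₀ : ((Fin n → ℕ) → ℚ) → ℚ
    E₀ = E (val zero)
    𝔼₀ = 𝔼-E (val zero)
    cost₀ : (Fin n → ℕ) → ℕ
    cost₀ = protocolCost (val zero)
    later-steps : ∀ h → expectIID E₀ T (λ g → toℚ (cost₀ h ℕ.+ totalCost (val ∘ suc) g))
                        ≡ toℚ (cost₀ h) + expectedCost (val ∘ suc)
    later-steps h = begin
      expectIID E₀ T (λ g → toℚ (cost₀ h ℕ.+ totalCost (val ∘ suc) g))
        ≡⟨ cong-on 𝔼ₜ (λ g _ → toℚ-+ (cost₀ h) (totalCost (val ∘ suc) g)) ⟩
      expectIID E₀ T (λ g → toℚ (cost₀ h) + toℚ (totalCost (val ∘ suc) g))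
        ≡⟨ +-homo 𝔼ₜ _ _ ⟩
      expectIID E₀ T (λ _ → toℚ (cost₀ h)) + expectedCost (val ∘ suc)
        ≡⟨ cong (_+ expectedCost (val ∘ suc)) (const 𝔼ₜ _) ⟩
      toℚ (cost₀ h) + expectedCost (val ∘ suc)
        ∎
      where 𝔼ₜ = expectIID-isExpectation 𝔼₀ T

  toℚ-sumDomains : ∀ T (val : Fin T → Fin n → Fin Δ) →
                   toℚ (sumDomains val) ≡ ∑[ t < T ] toℚ (domainSize (val t))
  toℚ-sumDomains zero val = refl
  toℚ-sumDomains (suc T) val = trans (toℚ-+ (domainSize (val zero)) _)
                                     (cong (λ x → toℚ (domainSize (val zero)) + x) (toℚ-sumDomains T (val ∘ suc)))

  expectedCost≥ : ∀ T (val : Fin T → Fin n → Fin Δ) → 2ℚ * toℚ (sumDomains val) ≤ expectedCost val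
  expectedCost≥ T val = begin
    2ℚ * toℚ (sumDomains val)                                 ≡⟨ cong (2ℚ *_) (toℚ-sumDomains T val) ⟩
    2ℚ * ∑[ t < T ] toℚ (domainSize (val t))                  ≡⟨ *-distribˡ-sum 2ℚ (toℚ ∘ domainSize ∘ val) ⟩
    ∑[ t < T ] (2ℚ * toℚ (domainSize (val t)))                ≤⟨ ∑-mono-≤ (Invocation.expectedProtocolCost≥ ∘ val) ⟩
    ∑[ t < T ] E (val t) (λ h → toℚ (protocolCost (val t) h))  ≡⟨ expectedCost≡∑ T val ⟨
    expectedCost val                                          ∎
    where open ℚₚ.≤-Reasoning

  expectedCost≤ : ∀ T (val : Fin T → Fin n → Fin Δ) →
                  expectedCost val ≤ 2ℚ * (2ℚ + 2ℚ) * toℚ (sumDomains val)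
  expectedCost≤ T val = begin
    expectedCost val                                          ≡⟨ expectedCost≡∑ T val ⟩
    ∑[ t < T ] E (val t) (λ h → toℚ (protocolCost (val t) h))  ≤⟨ ∑-mono-≤ (Invocation.expectedProtocolCost≤ ∘ val) ⟩
    ∑[ t < T ] (c * toℚ (domainSize (val t)))                 ≡⟨ *-distribˡ-sum c (toℚ ∘ domainSize ∘ val) ⟨
    c * ∑[ t < T ] toℚ (domainSize (val t))                   ≡⟨ cong (c *_) (toℚ-sumDomains T val) ⟨
    c * toℚ (sumDomains val)                                  ∎
    where
    open ℚₚ.≤-Reasoning
    c : ℚ
    c = 2ℚ * (2ℚ + 2ℚ)

open import Data.Nat using (_≤_)
import Data.Rational
open Expectation using (2ℚ)

-- Correctness holds for every choice of heights and the cost bounds also for n = 0.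
mainTheorem1 : ((n Δ T : ℕ) → 1 ≤ n → (val : Fin T → Fin n → Fin Δ) → (h : Fin T → Fin n → ℕ)
      → ((t : Fin T) → (i : Fin n) → InSupport (logN n) (h t i))
      → (t : Fin T) → (v : Fin Δ)
      → ((serverD (val t) (h t) v ≡ true → ∃ λ i → val t i ≡ v)
         × ((∃ λ i → val t i ≡ v) → serverD (val t) (h t) v ≡ true)
         × ((j : Fin n) → serverR (val t) (h t) v ≡ just j → val t j ≡ v)
         × (serverR (val t) (h t) v ≡ nothing → ¬ (∃ λ i → val t i ≡ v))))
    ×
    (Σ ℚ λ c₁ → Σ ℚ λ c₂ → (0ℚ < c₁) × (0ℚ < c₂)
      × ((n Δ T : ℕ) → 1 ≤ n → (val : Fin T → Fin n → Fin Δ)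
         → (c₁ * ((+ sumDomains val) / 1) Data.Rational.≤ expectedCost val)
         × (expectedCost val Data.Rational.≤ c₂ * ((+ sumDomains val) / 1))))
mainTheorem1 =
  (λ n Δ T _ val h _ t → Correctness.serverOutput-correct (val t) (h t)) ,
  2ℚ , 2ℚ * (2ℚ + 2ℚ) , ℚₚ.positive⁻¹ 2ℚ , ℚₚ.positive⁻¹ (2ℚ * (2ℚ + 2ℚ)) ,
  λ n Δ T _ val → Cost.expectedCost≥ T val , Cost.expectedCost≤ T val
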